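{- Let $p < q < r$ be primes with $r \le 2p-1$ such that each two of $p,q,r$ form a symmetric pair. Then $q \le \frac{3p-1}{2}$, and either $r = 2p-1$ or $q < r \le \frac{3p-1}{2}$.
   Context: Two distinct primes $p$ and $q$ form a symmetric pair if $\gcd(p-1, q-1) = |p-q|$ (an equivalent form of the definition via lattice points in the rectangle with corner $(p/2,q/2)$). A symmetric triple $(p,q,r)$ is a set of three primes $p<q<r$, any two of which form a symmetric pair; necessarily $r \le 2p-1$. -}

module Defs where

open import Data.Nat using (ℕ; _∸_; ∣_-_∣)
open import Data.Nat.GCD using (gcd)
open import Data.Nat.Primality using (Prime)
open import Data.Product using (_×_)
open import Relation.Binary.PropositionalEquality using (_≡_; _≢_)

SymmetricPair : ℕ → ℕ → Set
SymmetricPair p q = Prime p × Prime q × p ≢ q × gcd (p ∸ 1) (q ∸ 1) ≡ ∣ p - q ∣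

{-# OPTIONS --safe #-}
-- If p < q form a symmetric pair then d = q - p divides p - 1, so either d = p - 1,
-- i.e. q = 2p - 1, or d ≤ (p - 1)/2, i.e. 2q ≤ 3p - 1. Applied to q this leaves only
-- the second option, since q < r ≤ 2p - 1; applied to r it gives the dichotomy.
module Submission where

open import Defs
open import Data.Nat using (ℕ; _<_; _≤_; _*_; _∸_; _+_; suc; ∣_-_∣; s≤s; NonZero)
open import Data.Nat.Base using (nonTrivial⇒n>1; >-nonZero)
open import Data.Nat.Properties
open import Data.Nat.Divisibility using (_∣_; ∣⇒≤; quotient; quotient>1; m∣n⇒n≡quotient*m)
open import Data.Nat.GCD using (gcd; gcd[m,n]∣m)
open import Data.Nat.Primality using (Prime; prime⇒nonTrivial)
open import Data.Product using (_×_; _,_)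
open import Data.Sum using (_⊎_; inj₁; inj₂)
open import Relation.Binary.PropositionalEquality
open import Relation.Nullary using (contradiction)

divisor≡∨double≤ : ∀ {d n} .{{_ : NonZero n}} → d ∣ n → d ≡ n ⊎ 2 * d ≤ n
divisor≡∨double≤ {d} {n} d∣n with m≤n⇒m<n∨m≡n (∣⇒≤ d∣n)
... | inj₂ d≡n = inj₁ d≡n
... | inj₁ d<n = inj₂ (begin
  2 * d               ≤⟨ *-monoˡ-≤ d (quotient>1 d∣n d<n) ⟩
  quotient d∣n * d    ≡⟨ m∣n⇒n≡quotient*m d∣n ⟨
  n                   ∎)
  where open ≤-Reasoning

gcd[pred,pred]≡distance⇒distance∣pred : ∀ {p q} → p ≤ q →
  gcd (p ∸ 1) (q ∸ 1) ≡ ∣ p - q ∣ → q ∸ p ∣ p ∸ 1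
gcd[pred,pred]≡distance⇒distance∣pred {p} {q} p≤q g≡d =
  subst (_∣ p ∸ 1) (trans g≡d (m≤n⇒∣m-n∣≡n∸m p≤q)) (gcd[m,n]∣m (p ∸ 1) (q ∸ 1))

symmetric⇒≡2p-1∨2q≤3p-1 : ∀ {p q} → 1 < p → p < q →
  gcd (p ∸ 1) (q ∸ 1) ≡ ∣ p - q ∣ → q ≡ 2 * p ∸ 1 ⊎ 2 * q ≤ 3 * p ∸ 1
symmetric⇒≡2p-1∨2q≤3p-1 {suc n} {q} (s≤s 0<n) p<q g≡d
  with divisor≡∨double≤ {{>-nonZero 0<n}}
         (gcd[pred,pred]≡distance⇒distance∣pred (<⇒≤ p<q) g≡d)
... | inj₁ d≡n = inj₁ (begin
  q                   ≡⟨ q≡p+d ⟨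
  suc n + (q ∸ suc n) ≡⟨ cong (suc n +_) d≡n ⟩
  suc n + n           ≡⟨ +-comm (suc n) n ⟩
  n + suc n           ≡⟨ cong (n +_) (+-identityʳ (suc n)) ⟨
  2 * suc n ∸ 1       ∎)
  where open ≡-Reasoning
        q≡p+d = m+[n∸m]≡n (<⇒≤ p<q)
... | inj₂ 2d≤n = inj₂ (begin
  2 * q                         ≡⟨ cong (2 *_) q≡p+d ⟨
  2 * (suc n + (q ∸ suc n))     ≡⟨ *-distribˡ-+ 2 (suc n) (q ∸ suc n) ⟩
  2 * suc n + 2 * (q ∸ suc n)   ≤⟨ +-monoʳ-≤ (2 * suc n) 2d≤n ⟩
  2 * suc n + n                 ≡⟨ +-comm (2 * suc n) n ⟩
  3 * suc n ∸ 1                 ∎)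
  where open ≤-Reasoning
        q≡p+d = m+[n∸m]≡n (<⇒≤ p<q)

corollary1 : (p q r : ℕ) → Prime p → Prime q → Prime r → p < q → q < r → r ≤ 2 * p ∸ 1
    → SymmetricPair p q → SymmetricPair p r → SymmetricPair q r
    → (2 * q ≤ 3 * p ∸ 1) × (r ≡ 2 * p ∸ 1 ⊎ (q < r × 2 * r ≤ 3 * p ∸ 1))
corollary1 p q r prime-p _ _ p<q q<r r≤2p-1 (_ , _ , _ , sym-pq) (_ , _ , _ , sym-pr) _ =
  q-bound , r-bound
  where
  1<p : 1 < p
  1<p = nonTrivial⇒n>1 p {{prime⇒nonTrivial prime-p}}

  q-bound : 2 * q ≤ 3 * p ∸ 1
  q-bound with symmetric⇒≡2p-1∨2q≤3p-1 1<p p<q sym-pq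
  ... | inj₁ q≡2p-1 = contradiction (subst (_< r) q≡2p-1 q<r) (≤⇒≯ r≤2p-1)
  ... | inj₂ 2q≤3p-1 = 2q≤3p-1

  r-bound : r ≡ 2 * p ∸ 1 ⊎ (q < r × 2 * r ≤ 3 * p ∸ 1)
  r-bound with symmetric⇒≡2p-1∨2q≤3p-1 1<p (<-trans p<q q<r) sym-pr
  ... | inj₁ r≡2p-1 = inj₁ r≡2p-1
  ... | inj₂ 2r≤3p-1 = inj₂ (q<r , 2r≤3p-1)
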